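{- Let $G$ and $H$ be graphs. If $\mathrm{diam}(G\diamond H)=2$, then $$E((G\diamond H)_{SR})=TW(G\diamond H)\cup E(\overline{G}\Box\overline{H})\cup E(G\times\overline{H})\cup E(\overline{G}\times H),$$ where all the edge sets on the right are regarded as sets of pairs of vertices of $V(G)\times V(H)$.
   Context: All graphs are finite, simple and undirected. The modular product $G\diamond H$ has vertex set $V(G)\times V(H)$, and $(g,h)$, $(g',h')$ are adjacent if $g=g'$ and $hh'\in E(H)$, or $gg'\in E(G)$ and $h=h'$, or $gg'\in E(G)$ and $hh'\in E(H)$, or ($g\neq g'$, $h\neq h'$, $gg'\notin E(G)$ and $hh'\notin E(H)$). $\overline{X}$ is the complement of $X$. The Cartesian product $A\Box B$ has $(a,b)(a',b')$ as an edge iff ($a=a'$ and $bb'\in E(B)$) or ($aa'\in E(A)$ and $b=b'$); the direct product $A\times B$ has $(a,b)(a',b')$ as an edge iff $aa'\in E(A)$ and $bb'\in E(B)$. $TW(X)$ is the set of edges $uv$ of $X$ with $N_X[u]=N_X[v]$ (twin edges). A $u,v$-geodesic $P$ is maximal if it is not contained in any geodesic different from $P$; the strong resolving graph $X_{SR}$ has as vertices the end-vertices of maximal geodesics of $X$, with $uv\in E(X_{SR})$ iff there is a maximal $u,v$-geodesic in $X$. -}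

module Defs where

open import Data.Nat using (ℕ; suc; _≤_; _∸_)
open import Data.Fin using (Fin)
open import Data.List using (List; []; _∷_; _++_; length)
open import Data.Product using (Σ; ∃; ∃-syntax; _×_; _,_)
open import Data.Sum using (_⊎_)
open import Relation.Nullary using (¬_; Dec)
open import Relation.Binary.PropositionalEquality using (_≡_; _≢_)
open import Function.Bundles using (_↔_; _⇔_)

record Graph : Set₁ where
  field
    V        : Set
    E        : V → V → Set
    E-sym    : ∀ {u v} → E u v → E v u
    E-irrefl : ∀ {v} → ¬ E v v
    E-dec    : ∀ u v → Dec (E u v)
    size     : ℕ
    enum     : V ↔ Fin size

open Graph public

Compl : {V : Set} → (V → V → Set) → V → V → Set
Compl E u v = u ≢ v × ¬ E u v

Modular : (G H : Graph) → (V G × V H) → (V G × V H) → Set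
Modular G H (g , h) (g' , h') =
    (g ≡ g' × E H h h')
  ⊎ (E G g g' × h ≡ h')
  ⊎ (E G g g' × E H h h')
  ⊎ (g ≢ g' × h ≢ h' × ¬ E G g g' × ¬ E H h h')

Cartesian : {A B : Set} → (A → A → Set) → (B → B → Set) → (A × B) → (A × B) → Set
Cartesian EA EB (a , b) (a' , b') = (a ≡ a' × EB b b') ⊎ (EA a a' × b ≡ b')

Direct : {A B : Set} → (A → A → Set) → (B → B → Set) → (A × B) → (A × B) → Set
Direct EA EB (a , b) (a' , b') = EA a a' × EB b b'

module _ {V : Set} (E : V → V → Set) where

  data Walk : V → V → List V → Set where
    wnil  : ∀ {u} → Walk u u (u ∷ [])
    wcons : ∀ {u w v ps} → E u w → Walk w v ps → Walk u v (u ∷ ps)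

  DistIs : V → V → ℕ → Set
  DistIs u v k =
    (∃[ ps ] (Walk u v ps × length ps ≡ suc k))
    × (∀ ps → Walk u v ps → suc k ≤ length ps)

  Diam2 : Set
  Diam2 = (∀ u v → ∃[ k ] (k ≤ 2 × DistIs u v k))
        × (∃[ u ] ∃[ v ] DistIs u v 2)

  Geodesic : V → V → List V → Set
  Geodesic u v ps = Walk u v ps × (∀ qs → Walk u v qs → length ps ≤ length qs)

  SubPath : List V → List V → Set
  SubPath ps qs = ∃[ pre ] ∃[ suf ] (qs ≡ pre ++ ps ++ suf)

  -- maximal u,v-geodesic: every geodesic containing it is itself
  -- (equivalently, is not longer than it)
  MaximalGeodesic : V → V → List V → Set
  MaximalGeodesic u v ps =
    Geodesic u v ps
    × (∀ a b qs → Geodesic a b qs → SubPath ps qs → length qs ≤ length ps)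

  SREdge : V → V → Set
  SREdge u v = u ≢ v × ∃[ ps ] MaximalGeodesic u v ps

  TW : V → V → Set
  TW u v = E u v × (∀ z → (z ≡ u ⊎ E u z) ⇔ (z ≡ v ⊎ E v z))

{-# OPTIONS --safe #-}
module Submission where

-- When every two vertices are at distance at most 2, every geodesic has at
-- most three vertices. So any geodesic between distinct non-adjacent vertices
-- is already maximal, while the edge uv is a maximal geodesic exactly when no
-- neighbour of one end is at distance 2 from the other, i.e. when u and v are
-- twins. It remains to observe that the distinct non-adjacent pairs of G ◇ H
-- are precisely the edges of Ḡ □ H̄, G × H̄ and Ḡ × H.

open import Defs
open import Data.Empty using (⊥-elim)
open import Data.Fin using (_≟_)
open import Data.List using (List; []; _∷_; _++_; length)
open import Data.Nat using (_≤_; z≤n; s≤s)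
open import Data.Nat.Properties using (≤-refl; ≤-trans; ≤-reflexive; 1+n≰n; m≤n⇒m≤1+n)
open import Data.Product using (_×_; _,_; ∃-syntax)
open import Data.Product.Properties using (≡-dec)
open import Data.Sum using (_⊎_; inj₁; inj₂)
open import Data.Sum.Function.Propositional using (_⊎-⇔_)
open import Function.Bundles using (_⇔_; mk⇔; Equivalence)
open import Function.Properties.Inverse using (↔⇒↣)
import Function.Properties.Equivalence as ⇔
open import Relation.Binary.Definitions using (DecidableEquality)
open import Relation.Binary.PropositionalEquality using (_≡_; _≢_; refl; sym)
open import Relation.Nullary using (¬_; Dec; yes; no)
open import Relation.Nullary.Decidable using (_×-dec_; _⊎-dec_; ¬?; via-injection)

module DiamAtMostTwo {V : Set} (E : V → V → Set)
  (E-sym : ∀ {u v} → E u v → E v u) (E-irrefl : ∀ {v} → ¬ E v v)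
  (E-dec : ∀ u v → Dec (E u v)) (_≟V_ : DecidableEquality V)
  (diam≤2 : ∀ u v → ∃[ k ] (k ≤ 2 × DistIs E u v k)) where

  private
    variable
      a b u v z : V
      ps : List V

  Compl-sym : Compl E u v → Compl E v u
  Compl-sym (u≢v , ¬uv) = (λ v≡u → u≢v (sym v≡u)) , (λ vu → ¬uv (E-sym vu))

  closed-nbhd-or-Compl : ∀ v z → (z ≡ v ⊎ E v z) ⊎ Compl E z v
  closed-nbhd-or-Compl v z with z ≟V v | E-dec v z
  ... | yes z≡v | _      = inj₁ (inj₁ z≡v)
  ... | no _    | yes vz = inj₁ (inj₂ vz)
  ... | no z≢v  | no ¬vz = inj₂ (z≢v , λ zv → ¬vz (E-sym zv))

  Compl⇒∉closed-nbhd : Compl E z v → ¬ (z ≡ v ⊎ E v z)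
  Compl⇒∉closed-nbhd (z≢v , _)   (inj₁ z≡v) = z≢v z≡v
  Compl⇒∉closed-nbhd (_   , ¬zv) (inj₂ vz)  = ¬zv (E-sym vz)

  walk-length≥1 : Walk E u v ps → 1 ≤ length ps
  walk-length≥1 wnil        = s≤s z≤n
  walk-length≥1 (wcons _ _) = s≤s z≤n

  walk-length≥2 : u ≢ v → Walk E u v ps → 2 ≤ length ps
  walk-length≥2 u≢v wnil        = ⊥-elim (u≢v refl)
  walk-length≥2 _   (wcons _ w) = s≤s (walk-length≥1 w)

  walk-length≥3 : Compl E u v → Walk E u v ps → 3 ≤ length ps
  walk-length≥3 (u≢v , _)   wnil                  = ⊥-elim (u≢v refl)
  walk-length≥3 (_   , ¬uv) (wcons uv wnil)       = ⊥-elim (¬uv uv)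
  walk-length≥3 _           (wcons _ (wcons _ w)) = s≤s (s≤s (walk-length≥1 w))

  three-vertex-geodesic⇒Compl : ∀ {x y z} → Geodesic E a b (x ∷ y ∷ z ∷ []) → Compl E a b
  three-vertex-geodesic⇒Compl {a} {b} (_ , shortest) = a≢b , ¬ab
    where
    a≢b : a ≢ b
    a≢b refl with shortest _ wnil
    ... | s≤s ()
    ¬ab : ¬ E a b
    ¬ab ab with shortest _ (wcons ab wnil)
    ... | s≤s (s≤s ())

  Compl-short-walk⇒geodesic : Compl E a b → Walk E a b ps → length ps ≤ 3 → Geodesic E a b ps
  Compl-short-walk⇒geodesic c w |ps|≤3 = w , λ _ w′ → ≤-trans |ps|≤3 (walk-length≥3 c w′)

  short-walk : ∀ u v → ∃[ ps ] (Walk E u v ps × length ps ≤ 3)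
  short-walk u v with diam≤2 u v
  ... | _ , k≤2 , (ps , w , |ps|≡1+k) , _ = ps , w , ≤-trans (≤-reflexive |ps|≡1+k) (s≤s k≤2)

  geodesic-length≤3 : Geodesic E a b ps → length ps ≤ 3
  geodesic-length≤3 {a} {b} (_ , shortest) with short-walk a b
  ... | qs , w , |qs|≤3 = ≤-trans (shortest qs w) |qs|≤3

  Compl⇒SREdge : Compl E u v → SREdge E u v
  Compl⇒SREdge {u} {v} c@(u≢v , _) with short-walk u v
  ... | ps , w , |ps|≤3 =
    u≢v , ps , Compl-short-walk⇒geodesic c w |ps|≤3 ,
    λ _ _ _ g _ → ≤-trans (geodesic-length≤3 g) (walk-length≥3 c w)

  -- A geodesic has at most three vertices, and one with three vertices through
  -- a twin edge uv would give a shortcut through the other end of that edge.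
  twin-edge-maximal : TW E u v → ∀ pre suf →
    Geodesic E a b (pre ++ u ∷ v ∷ suf) → length (pre ++ u ∷ v ∷ suf) ≤ 2
  twin-edge-maximal _ [] [] _ = ≤-refl
  twin-edge-maximal (_ , twins) [] (w ∷ []) g@(wcons _ (wcons vw wnil) , _) =
    ⊥-elim (Compl⇒∉closed-nbhd (Compl-sym (three-vertex-geodesic⇒Compl g))
                               (Equivalence.from (twins w) (inj₂ vw)))
  twin-edge-maximal (_ , twins) (p ∷ []) [] g@(wcons pu (wcons _ wnil) , _) =
    ⊥-elim (Compl⇒∉closed-nbhd (three-vertex-geodesic⇒Compl g)
                               (Equivalence.to (twins p) (inj₂ (E-sym pu))))
  twin-edge-maximal _ [] (_ ∷ _ ∷ _) g with geodesic-length≤3 g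
  ... | s≤s (s≤s (s≤s ()))
  twin-edge-maximal _ (_ ∷ []) (_ ∷ _) g with geodesic-length≤3 g
  ... | s≤s (s≤s (s≤s ()))
  twin-edge-maximal {u = u} {v} _ (_ ∷ _ ∷ pre) suf g with geodesic-length≤3 g
  ... | s≤s (s≤s |rest|≤1) = ⊥-elim (1+n≰n (≤-trans (edge-in-middle pre) |rest|≤1))
    where
    edge-in-middle : ∀ pre → 2 ≤ length (pre ++ u ∷ v ∷ suf)
    edge-in-middle []         = s≤s (s≤s z≤n)
    edge-in-middle (_ ∷ pre′) = m≤n⇒m≤1+n (edge-in-middle pre′)

  twins⇒SREdge : TW E u v → SREdge E u v
  twins⇒SREdge {u} {v} t@(uv , _) =
    u≢v , u ∷ v ∷ [] , (wcons uv wnil , λ _ → walk-length≥2 u≢v) ,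
    λ { _ _ _ g (pre , suf , refl) → twin-edge-maximal t pre suf g }
    where
    u≢v : u ≢ v
    u≢v refl = E-irrefl uv

  edge-geodesic : E u v → Geodesic E u v ps → ps ≡ u ∷ v ∷ []
  edge-geodesic uv (wnil , _)         = ⊥-elim (E-irrefl uv)
  edge-geodesic _  (wcons _ wnil , _) = refl
  edge-geodesic uv (wcons _ (wcons _ w) , shortest) =
    ⊥-elim (1+n≰n (≤-trans (s≤s (s≤s (walk-length≥1 w))) (shortest _ (wcons uv wnil))))

  -- A neighbour of one end not in the closed neighbourhood of the other end
  -- would extend the edge to a longer geodesic.
  maximal-edge⇒twins : MaximalGeodesic E u v (u ∷ v ∷ []) → TW E u v
  maximal-edge⇒twins {u} {v} ((wcons uv wnil , _) , maximal) = uv , λ z → mk⇔ (to z) (from z)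
    where
    to : ∀ z → z ≡ u ⊎ E u z → z ≡ v ⊎ E v z
    to _ (inj₁ refl) = inj₂ (E-sym uv)
    to z (inj₂ uz) with closed-nbhd-or-Compl v z
    ... | inj₁ z∈N[v] = z∈N[v]
    ... | inj₂ c = ⊥-elim (1+n≰n (maximal z v _
            (Compl-short-walk⇒geodesic c (wcons (E-sym uz) (wcons uv wnil)) ≤-refl) (z ∷ [] , [] , refl)))
    from : ∀ z → z ≡ v ⊎ E v z → z ≡ u ⊎ E u z
    from _ (inj₁ refl) = inj₂ uv
    from z (inj₂ vz) with closed-nbhd-or-Compl u z
    ... | inj₁ z∈N[u] = z∈N[u]
    ... | inj₂ c = ⊥-elim (1+n≰n (maximal u z _
            (Compl-short-walk⇒geodesic (Compl-sym c) (wcons uv (wcons vz wnil)) ≤-refl) ([] , z ∷ [] , refl)))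

  SREdge⇒TW⊎Compl : SREdge E u v → TW E u v ⊎ Compl E u v
  SREdge⇒TW⊎Compl {u} {v} (u≢v , ps , maximal@(g , _)) with E-dec u v
  ... | no ¬uv = inj₂ (u≢v , ¬uv)
  ... | yes uv with edge-geodesic uv g
  ...   | refl = inj₁ (maximal-edge⇒twins maximal)

  SREdge⇔TW⊎Compl : ∀ u v → SREdge E u v ⇔ (TW E u v ⊎ Compl E u v)
  SREdge⇔TW⊎Compl u v = mk⇔ SREdge⇒TW⊎Compl λ { (inj₁ t) → twins⇒SREdge t ; (inj₂ c) → Compl⇒SREdge c }

Graph-≡-dec : (G : Graph) → DecidableEquality (V G)
Graph-≡-dec G = via-injection (↔⇒↣ (enum G)) _≟_

module _ (G H : Graph) where

  private
    _≟G_ = Graph-≡-dec G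
    _≟H_ = Graph-≡-dec H

  Modular-sym : ∀ {x y} → Modular G H x y → Modular G H y x
  Modular-sym (inj₁ (refl , hh′)) = inj₁ (refl , E-sym H hh′)
  Modular-sym (inj₂ (inj₁ (gg′ , refl))) = inj₂ (inj₁ (E-sym G gg′ , refl))
  Modular-sym (inj₂ (inj₂ (inj₁ (gg′ , hh′)))) = inj₂ (inj₂ (inj₁ (E-sym G gg′ , E-sym H hh′)))
  Modular-sym (inj₂ (inj₂ (inj₂ (g≢g′ , h≢h′ , ¬gg′ , ¬hh′)))) =
    inj₂ (inj₂ (inj₂ ((λ p → g≢g′ (sym p)) , (λ p → h≢h′ (sym p)) ,
                      (λ p → ¬gg′ (E-sym G p)) , (λ p → ¬hh′ (E-sym H p)))))

  Modular-irrefl : ∀ {x} → ¬ Modular G H x x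
  Modular-irrefl (inj₁ (_ , hh)) = E-irrefl H hh
  Modular-irrefl (inj₂ (inj₁ (gg , _))) = E-irrefl G gg
  Modular-irrefl (inj₂ (inj₂ (inj₁ (gg , _)))) = E-irrefl G gg
  Modular-irrefl (inj₂ (inj₂ (inj₂ (g≢g , _)))) = g≢g refl

  Modular-dec : ∀ x y → Dec (Modular G H x y)
  Modular-dec (g , h) (g′ , h′) =
            (g ≟G g′ ×-dec E-dec H h h′)
    ⊎-dec ((E-dec G g g′ ×-dec h ≟H h′)
    ⊎-dec ((E-dec G g g′ ×-dec E-dec H h h′)
    ⊎-dec (¬? (g ≟G g′) ×-dec ¬? (h ≟H h′) ×-dec ¬? (E-dec G g g′) ×-dec ¬? (E-dec H h h′))))

  CartesianOrDirect : V G × V H → V G × V H → Set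
  CartesianOrDirect x y = Cartesian (Compl (E G)) (Compl (E H)) x y
                        ⊎ Direct (E G) (Compl (E H)) x y
                        ⊎ Direct (Compl (E G)) (E H) x y

  Compl-Modular⇔ : ∀ x y → Compl (Modular G H) x y ⇔ CartesianOrDirect x y
  Compl-Modular⇔ _ _ = mk⇔ to from
    where
    to : ∀ {x y} → Compl (Modular G H) x y → CartesianOrDirect x y
    to {g , h} {g′ , h′} (x≢y , ¬xy) with g ≟G g′ | h ≟H h′ | E-dec G g g′ | E-dec H h h′
    ... | yes refl | yes refl | _        | _        = ⊥-elim (x≢y refl)
    ... | yes refl | no h≢h′  | _        | yes hh′  = ⊥-elim (¬xy (inj₁ (refl , hh′)))
    ... | yes refl | no h≢h′  | _        | no ¬hh′  = inj₁ (inj₁ (refl , h≢h′ , ¬hh′))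
    ... | no g≢g′  | yes refl | yes gg′  | _        = ⊥-elim (¬xy (inj₂ (inj₁ (gg′ , refl))))
    ... | no g≢g′  | yes refl | no ¬gg′  | _        = inj₁ (inj₂ ((g≢g′ , ¬gg′) , refl))
    ... | no g≢g′  | no h≢h′  | yes gg′  | yes hh′  = ⊥-elim (¬xy (inj₂ (inj₂ (inj₁ (gg′ , hh′)))))
    ... | no g≢g′  | no h≢h′  | yes gg′  | no ¬hh′  = inj₂ (inj₁ (gg′ , h≢h′ , ¬hh′))
    ... | no g≢g′  | no h≢h′  | no ¬gg′  | yes hh′  = inj₂ (inj₂ ((g≢g′ , ¬gg′) , hh′))
    ... | no g≢g′  | no h≢h′  | no ¬gg′  | no ¬hh′  =
      ⊥-elim (¬xy (inj₂ (inj₂ (inj₂ (g≢g′ , h≢h′ , ¬gg′ , ¬hh′)))))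
    from : ∀ {x y} → CartesianOrDirect x y → Compl (Modular G H) x y
    from (inj₁ (inj₁ (refl , h≢h′ , ¬hh′))) = (λ { refl → h≢h′ refl }) , λ
      { (inj₁ (_ , hh′)) → ¬hh′ hh′
      ; (inj₂ (inj₁ (gg , _))) → E-irrefl G gg
      ; (inj₂ (inj₂ (inj₁ (gg , _)))) → E-irrefl G gg
      ; (inj₂ (inj₂ (inj₂ (g≢g , _)))) → g≢g refl }
    from (inj₁ (inj₂ ((g≢g′ , ¬gg′) , refl))) = (λ { refl → g≢g′ refl }) , λ
      { (inj₁ (g≡g′ , _)) → g≢g′ g≡g′
      ; (inj₂ (inj₁ (gg′ , _))) → ¬gg′ gg′
      ; (inj₂ (inj₂ (inj₁ (_ , hh)))) → E-irrefl H hh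
      ; (inj₂ (inj₂ (inj₂ (_ , h≢h , _)))) → h≢h refl }
    from (inj₂ (inj₁ (gg′ , h≢h′ , ¬hh′))) = (λ { refl → h≢h′ refl }) , λ
      { (inj₁ (_ , hh′)) → ¬hh′ hh′
      ; (inj₂ (inj₁ (_ , h≡h′))) → h≢h′ h≡h′
      ; (inj₂ (inj₂ (inj₁ (_ , hh′)))) → ¬hh′ hh′
      ; (inj₂ (inj₂ (inj₂ (_ , _ , ¬gg′ , _)))) → ¬gg′ gg′ }
    from (inj₂ (inj₂ ((g≢g′ , ¬gg′) , hh′))) = (λ { refl → g≢g′ refl }) , λ
      { (inj₁ (g≡g′ , _)) → g≢g′ g≡g′
      ; (inj₂ (inj₁ (gg′ , _))) → ¬gg′ gg′
      ; (inj₂ (inj₂ (inj₁ (gg′ , _)))) → ¬gg′ gg′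
      ; (inj₂ (inj₂ (inj₂ (_ , _ , _ , ¬hh′)))) → ¬hh′ hh′ }

theorem4p4 : (G H : Graph) → Diam2 (Modular G H) →
    ∀ (x y : V G × V H) →
      SREdge (Modular G H) x y
        ⇔ (TW (Modular G H) x y
           ⊎ Cartesian (Compl (E G)) (Compl (E H)) x y
           ⊎ Direct (E G) (Compl (E H)) x y
           ⊎ Direct (Compl (E G)) (E H) x y)
theorem4p4 G H (diam≤2 , _) x y =
  ⇔.trans (SREdge⇔TW⊎Compl x y) (⇔.refl ⊎-⇔ Compl-Modular⇔ G H x y)
  where
  open DiamAtMostTwo (Modular G H) (Modular-sym G H) (Modular-irrefl G H) (Modular-dec G H)
                     (≡-dec (Graph-≡-dec G) (Graph-≡-dec H)) diam≤2
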